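{- Let $n$ be a positive integer and let $A$ be a set with $\{1, 3, \ldots, 2n-1\} \subset A \subseteq \{1, 2, \ldots, 2n\}$ and $|A| \ge n+4$. Then there exist pairwise distinct integers $b_1, b_2, b_3, b_4, b_5$ such that $b_i + b_j \in A$ for all $1 \le i < j \le 5$.
   Context: The integers $b_i$ are arbitrary integers (not required to be positive or to lie in $A$). -}

module Defs where

open import Data.Nat using (ℕ; suc; _*_; _+_)
open import Data.Fin using (Fin; toℕ)
open import Data.Fin.Subset using (Subset; _∈_)
open import Data.Integer using (ℤ; +_)
open import Data.Product using (Σ; _×_)
open import Relation.Binary.PropositionalEquality using (_≡_)

-- A subset A ⊆ {1,…,2n} is encoded as S : Subset (2 * n), where the
-- index k : Fin (2 * n) stands for the integer k + 1.

_∈ℤ_ : {n : ℕ} → ℤ → Subset (2 * n) → Set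
_∈ℤ_ {n} z S = Σ (Fin (2 * n)) (λ k → (k ∈ S) × (+ (suc (toℕ k)) ≡ z))

ContainsOdds : (n : ℕ) → Subset (2 * n) → Set
ContainsOdds n S = (i : Fin n) → _∈ℤ_ {n} (+ (suc (2 * toℕ i))) S

-- A has at most n odd elements, so it has four even ones 2h₁ < 2h₂ < 2h₃ < 2h₄. Pick w and
-- x < y < z among the hᵢ with z + 2 ≤ w + x + y and w + y + z + 2 ≤ 2n + x: (h₁, h₂, h₃, h₄)
-- works unless h₁ + h₂ + h₃ ≤ h₄ + 1, and then (h₃, h₁, h₂, h₃) does. Write
-- w + x + y − z = 1 + 2m + d with d ∈ {1, 2}. The integers w − d, w + d, x + y − z, x + z − y,
-- y + z − x are distinct, four of their pairwise sums are 2w, 2x, 2y, 2z ∈ A, and the other six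
-- are odd and lie between 2m + 1 and 2(m + d + z − x) + 1 ≤ 2n − 1, hence in A as well.

module Submission where

module Arithmetic where

  open import Data.Nat using (ℕ; zero; suc; _+_; _*_; _≤_; _<_; z≤n; s≤s; z<s)
  open import Data.Nat.Properties
    using ( ≤-refl; ≤-trans; <⇒≤; <-≤-trans; *-suc; +-assoc; +-mono-≤; +-monoˡ-≤; +-monoʳ-≤
          ; *-monoʳ-≤; +-cancelʳ-≤; *-cancelˡ-<; module ≤-Reasoning )
  open import Data.Nat.Tactic.RingSolver using (solve)
  open import Data.List using ([]; _∷_)
  open import Data.Product using (Σ; _×_; _,_)
  open import Relation.Binary.PropositionalEquality
    using (_≡_; refl; sym; trans; cong; module ≡-Reasoning)

  suc-parity : ∀ r → Σ ℕ λ m → Σ ℕ λ d → 0 < d × d ≤ 2 × suc r ≡ 2 * m + d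
  suc-parity zero          = 0 , 1 , z<s , s≤s z≤n , refl
  suc-parity (suc zero)    = 0 , 2 , z<s , ≤-refl , refl
  suc-parity (suc (suc r)) =
    let m , d , 0<d , d≤2 , eq = suc-parity r
    in suc m , d , 0<d , d≤2 , trans (cong (λ t → 2 + t) eq) (cong (_+ d) (sym (*-suc 2 m)))

  cross-sum : ∀ m z i x y j →
    suc (2 * (m + z + i)) + 2 * (x + y + j) ≡ suc (2 * (m + i + j)) + (x + y + z + (x + y + z))
  cross-sum m z i x y j = solve (m ∷ z ∷ i ∷ x ∷ y ∷ j ∷ [])

  balanced-pair-sum : ∀ w x y z m d → w + x + y ≡ z + suc (2 * m + d) →
    suc (2 * (m + z + 0)) + suc (2 * (m + z + d)) ≡ 2 * w + (x + y + z + (x + y + z))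
  balanced-pair-sum w x y z m d balance = begin
    suc (2 * (m + z + 0)) + suc (2 * (m + z + d))  ≡⟨ solve (m ∷ z ∷ d ∷ []) ⟩
    2 * (z + suc (2 * m + d)) + 2 * z               ≡⟨ cong (λ t → 2 * t + 2 * z) (sym balance) ⟩
    2 * (w + x + y) + 2 * z                         ≡⟨ solve (w ∷ x ∷ y ∷ z ∷ []) ⟩
    2 * w + (x + y + z + (x + y + z))               ∎
    where open ≡-Reasoning

  even-pair-sums : ∀ x y z →
    (2 * (x + y) + 2 * (x + z) ≡ 2 * x + (x + y + z + (x + y + z))) ×
    (2 * (x + y) + 2 * (y + z) ≡ 2 * y + (x + y + z + (x + y + z))) ×
    (2 * (x + z) + 2 * (y + z) ≡ 2 * z + (x + y + z + (x + y + z)))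
  even-pair-sums x y z =
    solve (x ∷ y ∷ z ∷ []) , solve (x ∷ y ∷ z ∷ []) , solve (x ∷ y ∷ z ∷ [])

  odd-sums-fit : ∀ n w x y z m d J → d ≤ 2 → w + x + y ≡ z + suc (2 * m + d) → x + J ≡ z →
    w + y + z + 2 ≤ 2 * n + x → m + d + J < n
  odd-sums-fit n w x y z m d J d≤2 balance x+J≡z bound =
    *-cancelˡ-< 2 _ _ (+-cancelʳ-≤ z _ _ (begin
      suc (2 * (m + d + J)) + z           ≡⟨ solve (m ∷ d ∷ J ∷ z ∷ []) ⟩
      z + suc (2 * m + d) + (d + 2 * J)   ≤⟨ +-monoʳ-≤ (z + suc (2 * m + d)) (+-monoˡ-≤ (2 * J) d≤2) ⟩
      z + suc (2 * m + d) + (2 + 2 * J)   ≡⟨ cong (_+ (2 + 2 * J)) (sym balance) ⟩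
      w + x + y + (2 + 2 * J)             ≡⟨ solve (w ∷ x ∷ y ∷ J ∷ []) ⟩
      w + y + (x + J) + 2 + J             ≡⟨ cong (λ t → w + y + t + 2 + J) x+J≡z ⟩
      w + y + z + 2 + J                   ≤⟨ +-monoˡ-≤ J bound ⟩
      2 * n + x + J                       ≡⟨ +-assoc (2 * n) x J ⟩
      2 * n + (x + J)                     ≡⟨ cong (λ t → 2 * n + t) x+J≡z ⟩
      2 * n + z                           ∎))
    where open ≤-Reasoning

  first-choice-fits : ∀ {n h₁ h₂ h₃ h₄} → h₁ < h₂ → h₃ < h₄ → h₄ ≤ n →
    h₁ + h₃ + h₄ + 2 ≤ 2 * n + h₂
  first-choice-fits {n} {h₁} {h₂} {h₃} {h₄} h₁<h₂ h₃<h₄ h₄≤n = begin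
    h₁ + h₃ + h₄ + 2        ≡⟨ solve (h₁ ∷ h₃ ∷ h₄ ∷ []) ⟩
    suc h₁ + (suc h₃ + h₄)  ≤⟨ +-mono-≤ h₁<h₂ (+-mono-≤ (<-≤-trans h₃<h₄ h₄≤n) h₄≤n) ⟩
    h₂ + (n + n)            ≡⟨ solve (h₂ ∷ n ∷ []) ⟩
    2 * n + h₂              ∎
    where open ≤-Reasoning

  second-choice-fits : ∀ {n h₁ h₂} h₃ {h₄} → 0 < h₁ → h₁ < h₂ → h₁ + h₂ + h₃ < h₄ + 2 → h₄ ≤ n →
    h₃ + h₂ + h₃ + 2 ≤ 2 * n + h₁
  second-choice-fits {n} {h₁} {h₂} h₃ {h₄} 0<h₁ h₁<h₂ h₁+h₂+h₃<h₄+2 h₄≤n =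
    +-cancelʳ-≤ (h₁ + h₁ + h₂) _ _ (begin
      h₃ + h₂ + h₃ + 2 + (h₁ + h₁ + h₂)  ≡⟨ solve (h₁ ∷ h₂ ∷ h₃ ∷ []) ⟩
      2 * suc (h₁ + h₂ + h₃)            ≤⟨ *-monoʳ-≤ 2 (<-≤-trans h₁+h₂+h₃<h₄+2 (+-monoˡ-≤ 2 h₄≤n)) ⟩
      2 * (n + 2)                        ≡⟨ solve (n ∷ []) ⟩
      2 * n + 4                          ≤⟨ +-monoʳ-≤ (2 * n) 4≤3h₁+h₂ ⟩
      2 * n + (h₁ + (h₁ + h₁ + h₂))      ≡⟨ sym (+-assoc (2 * n) h₁ (h₁ + h₁ + h₂)) ⟩
      2 * n + h₁ + (h₁ + h₁ + h₂)        ∎)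
    where
    open ≤-Reasoning
    4≤3h₁+h₂ : 4 ≤ h₁ + (h₁ + h₁ + h₂)
    4≤3h₁+h₂ = +-mono-≤ 0<h₁ (+-mono-≤ (+-mono-≤ 0<h₁ 0<h₁) (≤-trans 0<h₁ (<⇒≤ h₁<h₂)))

module Sumsets where

  open Arithmetic
  open import Defs
  open import Data.Nat
    using (ℕ; zero; suc; _+_; _*_; _≤_; _<_; z≤n; s≤s; z<s; s<s; _≤?_; ⌈_/2⌉)
  open import Data.Nat.Properties
    using ( ≤-refl; ≤-trans; ≤-reflexive; <-trans; ≤-<-trans; <⇒≤; <⇒≢; ≰⇒>
          ; n≤1+n; m≤n+m; m≤n⇒∃[o]m+o≡n; +-assoc; +-identityʳ; +-suc; *-suc; even≢odd
          ; +-mono-≤; +-monoʳ-≤; +-monoˡ-<; +-monoʳ-<; *-monoʳ-<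
          ; +-cancelˡ-≤; *-cancelˡ-≤; n≡⌈n+n/2⌉; +-commutativeSemigroup )
  open import Algebra.Properties.CommutativeSemigroup +-commutativeSemigroup using (interchange)
  open import Data.Integer using (ℤ; +_; _-_) renaming (_+_ to _+ℤ_)
  open import Data.Integer.Properties using (pos-+; +-injective)
  import Data.Integer.Tactic.RingSolver as ℤ-Ring
  open import Data.Fin as Fin using (Fin; zero; suc; toℕ; fromℕ<)
  open import Data.Fin.Properties using (toℕ<n; toℕ-fromℕ<)
  open import Data.Fin.Subset using (Side; Subset; _∈_; ∣_∣; inside; outside)
  open import Data.Fin.Subset.Properties using (∣p∣≤n)
  open import Data.List using (List; []; _∷_; map; length)
  open import Data.List.Properties using (length-map)
  open import Data.List.Relation.Unary.All using (All; []; _∷_)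
  import Data.List.Relation.Unary.All as All
  import Data.List.Relation.Unary.All.Properties as Allₚ
  open import Data.List.Relation.Unary.Linked using (Linked; []; [-]; _∷_)
  import Data.List.Relation.Unary.Linked as Linked
  import Data.List.Relation.Unary.Linked.Properties as Linkedₚ
  open import Data.Vec as Vec using (Vec; []; _∷_; lookup; here; there)
  open import Data.Vec.Relation.Unary.All using ([]; _∷_)
  import Data.Vec.Relation.Unary.All.Properties as VecAllₚ
  open import Data.Vec.Relation.Unary.AllPairs using (AllPairs; []; _∷_)
  import Data.Vec.Relation.Unary.AllPairs as AllPairs
  import Data.Vec.Relation.Unary.AllPairs.Properties as AllPairsₚ
  open import Data.Vec.Relation.Unary.Unique.Propositional using (Unique)
  import Data.Vec.Relation.Unary.Unique.Propositional.Properties as Uniqueₚ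
  open import Data.Product using (Σ; _×_; _,_; proj₁; proj₂)
  open import Function.Definitions using (Injective)
  open import Relation.Binary.Core using (Rel)
  open import Relation.Nullary using (yes; no)
  open import Relation.Binary.PropositionalEquality
    using (_≡_; _≢_; refl; sym; trans; cong; cong₂; subst; module ≡-Reasoning)

  infix 4 _∈ℕ_

  _∈ℕ_ : ∀ {m} → ℕ → Subset m → Set
  N ∈ℕ p = Σ (Fin _) λ k → k ∈ p × suc (toℕ k) ≡ N

  allPairs-lookup : ∀ {a ℓ} {X : Set a} {R : Rel X ℓ} {k} {xs : Vec X k} →
                    AllPairs R xs → ∀ {i j} → i Fin.< j → R (lookup xs i) (lookup xs j)
  allPairs-lookup _         {j = zero}    ()
  allPairs-lookup (Rx ∷ _)  {zero}  {suc j} _         = VecAllₚ.lookup⁺ Rx j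
  allPairs-lookup (_ ∷ Rxs) {suc i} {suc j} (s<s i<j) = allPairs-lookup Rxs i<j

  -- Integers are handled as P − L with P and L natural, so that all arithmetic happens in ℕ.
  shift : ℕ → ℕ → ℤ
  shift L P = + P - + L

  shift-sum : ∀ L {P Q N} → P + Q ≡ N + (L + L) → shift L P +ℤ shift L Q ≡ + N
  shift-sum L {P} {Q} {N} eq = begin
    (+ P - + L) +ℤ (+ Q - + L)      ≡⟨ regroup (+ P) (+ Q) (+ L) ⟩
    (+ P +ℤ + Q) - (+ L +ℤ + L)     ≡⟨ cong₂ _-_ (sym (pos-+ P Q)) (sym (pos-+ L L)) ⟩
    + (P + Q) - + (L + L)           ≡⟨ cong (λ t → + t - + (L + L)) eq ⟩
    + (N + (L + L)) - + (L + L)     ≡⟨ cong (_- + (L + L)) (pos-+ N (L + L)) ⟩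
    (+ N +ℤ + (L + L)) - + (L + L)  ≡⟨ cancel (+ N) (+ (L + L)) ⟩
    + N                             ∎
    where
    open ≡-Reasoning
    regroup : ∀ a b c → (a - c) +ℤ (b - c) ≡ (a +ℤ b) - (c +ℤ c)
    regroup = ℤ-Ring.solve-∀
    cancel : ∀ a b → (a +ℤ b) - b ≡ a
    cancel = ℤ-Ring.solve-∀

  shift-injective : ∀ L {P Q} → shift L P ≡ shift L Q → P ≡ Q
  shift-injective L {P} {Q} eq = +-injective (begin
    + P                  ≡⟨ sym (cancel (+ P) (+ L)) ⟩
    (+ P - + L) +ℤ + L   ≡⟨ cong (_+ℤ + L) eq ⟩
    (+ Q - + L) +ℤ + L   ≡⟨ cancel (+ Q) (+ L) ⟩
    + Q                  ∎)
    where
    open ≡-Reasoning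
    cancel : ∀ a b → (a - b) +ℤ b ≡ a
    cancel = ℤ-Ring.solve-∀

  evenHalves : ∀ {m} → Subset m → List ℕ
  evenHalves []                = []
  evenHalves (_ ∷ [])          = []
  evenHalves (_ ∷ outside ∷ p) = map suc (evenHalves p)
  evenHalves (_ ∷ inside  ∷ p) = 1 ∷ map suc (evenHalves p)

  ∣x∷p∣≤1+∣p∣ : ∀ {m} x (p : Subset m) → ∣ x ∷ p ∣ ≤ suc ∣ p ∣
  ∣x∷p∣≤1+∣p∣ outside p = n≤1+n ∣ p ∣
  ∣x∷p∣≤1+∣p∣ inside  p = ≤-refl

  ∣p∣≤⌈m/2⌉+∣evenHalves∣ : ∀ {m} (p : Subset m) → ∣ p ∣ ≤ ⌈ m /2⌉ + length (evenHalves p)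
  ∣p∣≤⌈m/2⌉+∣evenHalves∣ []       = z≤n
  ∣p∣≤⌈m/2⌉+∣evenHalves∣ (x ∷ []) = ∣p∣≤n (x ∷ [])
  ∣p∣≤⌈m/2⌉+∣evenHalves∣ {suc (suc m)} (x ∷ y ∷ p) =
    ≤-trans (∣x∷p∣≤1+∣p∣ x (y ∷ p)) (s≤s (step y))
    where
    IH : ∣ p ∣ ≤ ⌈ m /2⌉ + length (map suc (evenHalves p))
    IH = subst (λ l → ∣ p ∣ ≤ ⌈ m /2⌉ + l) (sym (length-map suc (evenHalves p)))
               (∣p∣≤⌈m/2⌉+∣evenHalves∣ p)
    step : ∀ b → ∣ b ∷ p ∣ ≤ ⌈ m /2⌉ + length (evenHalves (x ∷ b ∷ p))
    step outside = IH
    step inside  = ≤-trans (s≤s IH) (≤-reflexive (sym (+-suc _ _)))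

  lower-head : ∀ {a b xs} → a ≤ b → Linked _<_ (b ∷ xs) → Linked _<_ (a ∷ xs)
  lower-head _   [-]       = [-]
  lower-head a≤b (b<c ∷ l) = ≤-<-trans a≤b b<c ∷ l

  evenHalves-increasing : ∀ {m} (p : Subset m) → Linked _<_ (0 ∷ evenHalves p)
  evenHalves-increasing []                = [-]
  evenHalves-increasing (_ ∷ [])          = [-]
  evenHalves-increasing (_ ∷ outside ∷ p) =
    lower-head z≤n (Linkedₚ.map⁺ (Linked.map s<s (evenHalves-increasing p)))
  evenHalves-increasing (_ ∷ inside  ∷ p) =
    z<s ∷ Linkedₚ.map⁺ (Linked.map s<s (evenHalves-increasing p))

  2h∈p⇒2[1+h]∈x∷y∷p : ∀ {m h} {x y : Side} {p : Subset m} → 2 * h ∈ℕ p → 2 * suc h ∈ℕ x ∷ y ∷ p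
  2h∈p⇒2[1+h]∈x∷y∷p {h = h} (k , k∈p , eq) =
    suc (suc k) , there (there k∈p) , trans (cong (λ t → 2 + t) eq) (sym (*-suc 2 h))

  evenHalves-members : ∀ {m} (p : Subset m) → All (λ h → 2 * h ∈ℕ p) (evenHalves p)
  evenHalves-members []                = []
  evenHalves-members (_ ∷ [])          = []
  evenHalves-members (_ ∷ outside ∷ p) =
    Allₚ.map⁺ (All.map 2h∈p⇒2[1+h]∈x∷y∷p (evenHalves-members p))
  evenHalves-members (_ ∷ inside  ∷ p) =
    (suc zero , there here , refl) ∷ Allₚ.map⁺ (All.map 2h∈p⇒2[1+h]∈x∷y∷p (evenHalves-members p))

  -- Shifted by L = x + y + z, the summands w − d, w + d, x + y − z, x + z − y, y + z − x
  -- become these, using w + x + y = z + 1 + 2m + d for the first two.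
  shiftedSummands : (x y z m d : ℕ) → Vec ℕ 5
  shiftedSummands x y z m d =
    suc (2 * (m + z + 0)) ∷ suc (2 * (m + z + d)) ∷ 2 * (x + y) ∷ 2 * (x + z) ∷ 2 * (y + z) ∷ []

  shiftedSummands-unique : ∀ {x y z d} m → x < y → y < z → 0 < d →
    Unique (shiftedSummands x y z m d)
  shiftedSummands-unique {x} {y} {z} {d} m x<y y<z 0<d =
      (<⇒≢ odd-0<odd-d ∷ odd≢even 0 (x + y) ∷ odd≢even 0 (x + z) ∷ odd≢even 0 (y + z) ∷ [])
    ∷ (odd≢even d (x + y) ∷ odd≢even d (x + z) ∷ odd≢even d (y + z) ∷ [])
    ∷ (<⇒≢ 2[x+y]<2[x+z] ∷ <⇒≢ (<-trans 2[x+y]<2[x+z] 2[x+z]<2[y+z]) ∷ [])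
    ∷ (<⇒≢ 2[x+z]<2[y+z] ∷ [])
    ∷ [] ∷ []
    where
    odd≢even : ∀ i s → suc (2 * (m + z + i)) ≢ 2 * s
    odd≢even i s eq = even≢odd s (m + z + i) (sym eq)
    odd-0<odd-d : suc (2 * (m + z + 0)) < suc (2 * (m + z + d))
    odd-0<odd-d = s<s (*-monoʳ-< 2 (+-monoʳ-< (m + z) 0<d))
    2[x+y]<2[x+z] : 2 * (x + y) < 2 * (x + z)
    2[x+y]<2[x+z] = *-monoʳ-< 2 (+-monoʳ-< x y<z)
    2[x+z]<2[y+z] : 2 * (x + z) < 2 * (y + z)
    2[x+z]<2[y+z] = *-monoʳ-< 2 (+-monoˡ-< z x<y)

  module _ {n : ℕ} (A : Subset (2 * n)) where

    SumIn : ℤ → ℤ → Set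
    SumIn a b = _∈ℤ_ {n} (a +ℤ b) A

    DistinctSummands : ℕ → Set
    DistinctSummands k =
      Σ (Fin k → ℤ) λ b → Injective _≡_ _≡_ b × (∀ i j → i Fin.< j → SumIn (b i) (b j))

    record ShiftedSumIn (L P Q : ℕ) : Set where
      constructor sum-in
      field
        N         : ℕ
        N∈A       : N ∈ℕ A
        P+Q≡N+2L  : P + Q ≡ N + (L + L)

    summands-from-shifted : ∀ {k} L (Ps : Vec ℕ k) →
      Unique Ps → AllPairs (ShiftedSumIn L) Ps → DistinctSummands k
    summands-from-shifted {k} L Ps distinct sums =
      lookup bs ,
      (λ {i} {j} → Uniqueₚ.lookup-injective bs-distinct i j) ,
      (λ i j → allPairs-lookup bs-sums)
      where
      bs : Vec ℤ k
      bs = Vec.map (shift L) Ps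
      bs-distinct : Unique bs
      bs-distinct = Uniqueₚ.map⁺ (shift-injective L) distinct
      shifted-in-A : ∀ {P Q} → ShiftedSumIn L P Q → SumIn (shift L P) (shift L Q)
      shifted-in-A (sum-in N (k , k∈A , k+1≡N) eq) =
        k , k∈A , trans (cong +_ k+1≡N) (sym (shift-sum L eq))
      bs-sums : AllPairs SumIn bs
      bs-sums = AllPairsₚ.map⁺ (AllPairs.map shifted-in-A sums)

    2h∈A⇒h≤n : ∀ {h} → 2 * h ∈ℕ A → h ≤ n
    2h∈A⇒h≤n (k , _ , k+1≡2h) = *-cancelˡ-≤ 2 (subst (_≤ 2 * n) k+1≡2h (toℕ<n k))

    odd-members : ContainsOdds n A → ∀ k → k < n → suc (2 * k) ∈ℕ A
    odd-members odds k k<n =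
      let j , j∈A , eq = odds (fromℕ< k<n)
      in j , j∈A , trans (+-injective eq) (cong (λ t → suc (2 * t)) (toℕ-fromℕ< k<n))

    ≥4-evenHalves : n + 4 ≤ ∣ A ∣ → 4 ≤ length (evenHalves A)
    ≥4-evenHalves card =
      +-cancelˡ-≤ n 4 _ (≤-trans card (subst (λ c → ∣ A ∣ ≤ c + length (evenHalves A)) ⌈2n/2⌉≡n
                                            (∣p∣≤⌈m/2⌉+∣evenHalves∣ A)))
      where
      ⌈2n/2⌉≡n : ⌈ 2 * n /2⌉ ≡ n
      ⌈2n/2⌉≡n = sym (trans (n≡⌈n+n/2⌉ n) (cong (λ t → ⌈ n + t /2⌉) (sym (+-identityʳ n))))

    module _ (odd∈A : ∀ k → k < n → suc (2 * k) ∈ℕ A) where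

      shiftedSummands-sums : ∀ {w x y z p q} m d → x + p ≡ y → y + q ≡ z →
        w + x + y ≡ z + suc (2 * m + d) → m + d + (p + q) < n →
        2 * w ∈ℕ A → 2 * x ∈ℕ A → 2 * y ∈ℕ A → 2 * z ∈ℕ A →
        AllPairs (ShiftedSumIn (x + y + z)) (shiftedSummands x y z m d)
      shiftedSummands-sums {w} {x} {y} {z} {p} {q} m d
        x+p≡y y+q≡z balance bound 2w∈A 2x∈A 2y∈A 2z∈A =
          (sum-in _ 2w∈A (balanced-pair-sum w x y z m d balance)
            ∷ cross 0 0 z≤n z≤n (+-identityʳ (x + y))
            ∷ cross 0 q z≤n (m≤n+m q p) xz-offset
            ∷ cross 0 (p + q) z≤n ≤-refl yz-offset ∷ [])
        ∷ (cross d 0 ≤-refl z≤n (+-identityʳ (x + y))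
            ∷ cross d q ≤-refl (m≤n+m q p) xz-offset
            ∷ cross d (p + q) ≤-refl ≤-refl yz-offset ∷ [])
        ∷ (sum-in _ 2x∈A (proj₁ (even-pair-sums x y z))
            ∷ sum-in _ 2y∈A (proj₁ (proj₂ (even-pair-sums x y z))) ∷ [])
        ∷ (sum-in _ 2z∈A (proj₂ (proj₂ (even-pair-sums x y z))) ∷ [])
        ∷ [] ∷ []
        where
        -- The odd sums are 1 + 2(m + i + j) with i ∈ {0, d} and j ∈ {0, z − y, z − x}.
        cross : ∀ i j {s} → i ≤ d → j ≤ p + q → x + y + j ≡ s →
                ShiftedSumIn (x + y + z) (suc (2 * (m + z + i))) (2 * s)
        cross i j i≤d j≤p+q refl =
          sum-in _ (odd∈A (m + i + j) (≤-<-trans (+-mono-≤ (+-monoʳ-≤ m i≤d) j≤p+q) bound))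
                 (cross-sum m z i x y j)
        xz-offset : x + y + q ≡ x + z
        xz-offset = trans (+-assoc x y q) (cong (λ t → x + t) y+q≡z)
        yz-offset : x + y + (p + q) ≡ y + z
        yz-offset = trans (interchange x y p q) (cong₂ _+_ x+p≡y y+q≡z)

      summands-from-evens : ∀ {w x y z} → x < y → y < z →
        z + 2 ≤ w + x + y → w + y + z + 2 ≤ 2 * n + x →
        2 * w ∈ℕ A → 2 * x ∈ℕ A → 2 * y ∈ℕ A → 2 * z ∈ℕ A → DistinctSummands 5
      summands-from-evens {w} {x} {y} {z} x<y y<z low high 2w∈A 2x∈A 2y∈A 2z∈A
        with m≤n⇒∃[o]m+o≡n (<⇒≤ x<y) | m≤n⇒∃[o]m+o≡n (<⇒≤ y<z) | m≤n⇒∃[o]m+o≡n low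
      ... | p , x+p≡y | q , y+q≡z | r , z+2+r≡w+x+y with suc-parity r
      ... | m , d , 0<d , d≤2 , 1+r≡2m+d =
        summands-from-shifted (x + y + z) (shiftedSummands x y z m d)
          (shiftedSummands-unique m x<y y<z 0<d)
          (shiftedSummands-sums m d x+p≡y y+q≡z balance
             (odd-sums-fit n w x y z m d (p + q) d≤2 balance x+[p+q]≡z high) 2w∈A 2x∈A 2y∈A 2z∈A)
        where
        open ≡-Reasoning
        balance : w + x + y ≡ z + suc (2 * m + d)
        balance = begin
          w + x + y           ≡⟨ sym z+2+r≡w+x+y ⟩
          z + 2 + r           ≡⟨ +-assoc z 2 r ⟩
          z + suc (suc r)     ≡⟨ cong (λ t → z + suc t) 1+r≡2m+d ⟩
          z + suc (2 * m + d) ∎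
        x+[p+q]≡z : x + (p + q) ≡ z
        x+[p+q]≡z = trans (sym (+-assoc x p q)) (trans (cong (_+ q) x+p≡y) y+q≡z)

      summands-from-four-evens : ∀ {h₁ h₂ h₃ h₄} → 0 < h₁ → h₁ < h₂ → h₂ < h₃ → h₃ < h₄ → h₄ ≤ n →
        2 * h₁ ∈ℕ A → 2 * h₂ ∈ℕ A → 2 * h₃ ∈ℕ A → 2 * h₄ ∈ℕ A → DistinctSummands 5
      summands-from-four-evens {h₁} {h₂} {h₃} {h₄}
        0<h₁ h₁<h₂ h₂<h₃ h₃<h₄ h₄≤n 2h₁∈A 2h₂∈A 2h₃∈A 2h₄∈A with h₄ + 2 ≤? h₁ + h₂ + h₃
      ... | yes low =
        summands-from-evens h₂<h₃ h₃<h₄ low (first-choice-fits h₁<h₂ h₃<h₄ h₄≤n)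
          2h₁∈A 2h₂∈A 2h₃∈A 2h₄∈A
      ... | no ¬low =
        summands-from-evens h₁<h₂ h₂<h₃ low (second-choice-fits h₃ 0<h₁ h₁<h₂ (≰⇒> ¬low) h₄≤n)
          2h₃∈A 2h₁∈A 2h₂∈A 2h₃∈A
        where
        low : h₃ + 2 ≤ h₃ + h₁ + h₂
        low = ≤-trans (+-monoʳ-≤ h₃ (+-mono-≤ 0<h₁ (≤-trans 0<h₁ (<⇒≤ h₁<h₂))))
                      (≤-reflexive (sym (+-assoc h₃ h₁ h₂)))

      summands-from-sorted-halves : ∀ {hs} → 4 ≤ length hs → Linked _<_ (0 ∷ hs) →
        All (λ h → 2 * h ∈ℕ A) hs → DistinctSummands 5
      summands-from-sorted-halves {_ ∷ _ ∷ _ ∷ _ ∷ _} _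
        (0<h₁ ∷ h₁<h₂ ∷ h₂<h₃ ∷ h₃<h₄ ∷ _) (2h₁∈A ∷ 2h₂∈A ∷ 2h₃∈A ∷ 2h₄∈A ∷ _) =
        summands-from-four-evens 0<h₁ h₁<h₂ h₂<h₃ h₃<h₄ (2h∈A⇒h≤n 2h₄∈A) 2h₁∈A 2h₂∈A 2h₃∈A 2h₄∈A
      summands-from-sorted-halves {[]}                 ()
      summands-from-sorted-halves {_ ∷ []}             (s≤s ())
      summands-from-sorted-halves {_ ∷ _ ∷ []}         (s≤s (s≤s ()))
      summands-from-sorted-halves {_ ∷ _ ∷ _ ∷ []}     (s≤s (s≤s (s≤s ())))

-- The statement's imports come last: here _<_ is the order on Fin, above it is the one on ℕ.
open import Defs
open import Data.Nat using (ℕ; suc; _*_; _+_; _≤_; NonZero)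
open import Data.Fin using (Fin; _<_)
open import Data.Fin.Subset using (Subset; ∣_∣)
open import Data.Integer using (ℤ) renaming (_+_ to _+ℤ_)
open import Data.Product using (Σ; _×_)
open import Function.Definitions using (Injective)
open import Relation.Binary.PropositionalEquality using (_≡_)
open Sumsets

theorem7 : (n : ℕ) → .{{_ : NonZero n}} → (A : Subset (2 * n)) →
    ContainsOdds n A → n + 4 ≤ ∣ A ∣ →
    Σ (Fin 5 → ℤ) (λ b → Injective _≡_ _≡_ b ×
    ((i j : Fin 5) → i < j → _∈ℤ_ {n} (b i +ℤ b j) A))
theorem7 n A odds card =
  summands-from-sorted-halves A (odd-members A odds) (≥4-evenHalves A card)
    (evenHalves-increasing A) (evenHalves-members A)
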